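{- Let $P$ be the Petersen graph with vertices $v_1,\dots,v_5,u_1,\dots,u_5$, where $v_1v_2v_3v_4v_5$ and $u_1u_3u_5u_2u_4$ are 5-cycles and $u_iv_i \in E(P)$ for $i=1,\dots,5$. Let $M_0=\{u_iv_i : i=1,\dots,5\}$ and for $i \in \{1,\dots,5\}$ let $M_i$ be the unique perfect matching of $P$ different from $M_0$ that contains $u_iv_i$. For $k\geq 1$ let $P_k = P + kM_0 + (k-1)(M_1+M_3+M_4)$. Then for all $k \geq 1$, $P_k$ is $4k$-edge-connected and $4k$-regular.
   Context: Graphs may have parallel edges but no loops. For a graph $G$ and subsets $N_1,\dots,N_m \subseteq E(G)$, $G + (N_1+\dots+N_m)$ denotes the graph on $V(G)$ obtained by adding, for each $i$, a new parallel copy of every edge of $N_i$; a term $cN$ means $N$ is added $c$ times. Thus in $P_k$ an edge $e$ of $P$ has multiplicity $1 + k\cdot[e\in M_0] + (k-1)\cdot|\{j\in\{1,3,4\}: e \in M_j\}|$. -}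

module Defs where

open import Data.Nat using (ℕ; zero; suc; _+_; _*_; _∸_; _≤_; _<_)
open import Data.Fin using (Fin; zero; suc; #_)
open import Data.Bool using (Bool; true; false; if_then_else_)
open import Data.Product using (_×_; _,_; proj₁; proj₂; ∃-syntax)
open import Data.Sum using (_⊎_)
open import Data.List using (List; map; allFin)
open import Data.Nat.ListAction using (sum)

open import Data.Vec using (Vec; []; _∷_; lookup)
open import Relation.Binary.PropositionalEquality using (_≡_; _≢_)

-- Edges: Fin 15, each with its two endpoints:
--   0..4  : outer 5-cycle v1v2, v2v3, v3v4, v4v5, v5v1
--   5..9  : inner 5-cycle u1u3, u3u5, u5u2, u2u4, u4u1
--   10..14: spokes u_i v_i, i = 1..5

Vertex : Set
Vertex = Fin 10

Edge : Set
Edge = Fin 15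

v : Fin 5 → Vertex
v i = lookup (# 0 ∷ # 1 ∷ # 2 ∷ # 3 ∷ # 4 ∷ []) i

u : Fin 5 → Vertex
u i = lookup (# 5 ∷ # 6 ∷ # 7 ∷ # 8 ∷ # 9 ∷ []) i

-- (index i : Fin 5 stands for the paper's subscript i+1)
endpointTable : Vec (Vertex × Vertex) 15
endpointTable =
  (v (# 0) , v (# 1)) ∷ (v (# 1) , v (# 2)) ∷ (v (# 2) , v (# 3)) ∷ (v (# 3) , v (# 4)) ∷ (v (# 4) , v (# 0)) ∷
  (u (# 0) , u (# 2)) ∷ (u (# 2) , u (# 4)) ∷ (u (# 4) , u (# 1)) ∷ (u (# 1) , u (# 3)) ∷ (u (# 3) , u (# 0)) ∷
  (u (# 0) , v (# 0)) ∷ (u (# 1) , v (# 1)) ∷ (u (# 2) , v (# 2)) ∷ (u (# 3) , v (# 3)) ∷ (u (# 4) , v (# 4)) ∷ []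

ends : Edge → Vertex × Vertex
ends e = lookup endpointTable e

_incident_ : Vertex → Edge → Set
x incident e = (proj₁ (ends e) ≡ x) ⊎ (proj₂ (ends e) ≡ x)

spoke : Fin 5 → Edge
spoke i = lookup (# 10 ∷ # 11 ∷ # 12 ∷ # 13 ∷ # 14 ∷ []) i

EdgeSet : Set
EdgeSet = Edge → Bool

_∈ₑ_ : Edge → EdgeSet → Set
e ∈ₑ N = N e ≡ true

IsPerfectMatching : EdgeSet → Set
IsPerfectMatching M =
  (x : Vertex) → ∃[ e ] (e ∈ₑ M × x incident e ×
                          ((f : Edge) → f ∈ₑ M → x incident f → f ≡ e))

M₀ : EdgeSet
M₀ e = lookup (false ∷ false ∷ false ∷ false ∷ false ∷
               false ∷ false ∷ false ∷ false ∷ false ∷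
               true ∷ true ∷ true ∷ true ∷ true ∷ []) e

IsMatchingAt : Fin 5 → EdgeSet → Set
IsMatchingAt i M = IsPerfectMatching M × (∃[ e ] M e ≢ M₀ e) × spoke i ∈ₑ M

-- Multigraphs on V(P) whose edges are parallel copies of edges of P,
-- represented by the multiplicity of each edge of P.

Multigraph : Set
Multigraph = Edge → ℕ

[_] : Bool → ℕ
[ true ] = 1
[ false ] = 0

Pk : ℕ → (M₁ M₃ M₄ : EdgeSet) → Multigraph
Pk k M₁ M₃ M₄ e = 1 + k * [ M₀ e ] + (k ∸ 1) * ([ M₁ e ] + [ M₃ e ] + [ M₄ e ])

Σₑ : (Edge → ℕ) → ℕ
Σₑ f = sum (map f (allFin 15))

-- degree of x in G: number of edges (counted with multiplicity) at x
-- (no loops, so each incident edge contributes its multiplicity once)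
degree : Multigraph → Vertex → ℕ
degree G x = Σₑ (λ e → if isEnd x e then G e else 0)
  where
  open import Data.Fin using (_≟_)
  open import Relation.Nullary using (does)
  open import Data.Bool using (_∨_)
  isEnd : Vertex → Edge → Bool
  isEnd x e = does (proj₁ (ends e) ≟ x) ∨ does (proj₂ (ends e) ≟ x)

IsRegular : ℕ → Multigraph → Set
IsRegular r G = (x : Vertex) → degree G x ≡ r

data Reachable (G : Multigraph) : Vertex → Vertex → Set where
  here : ∀ {x} → Reachable G x x
  step₁ : ∀ {y} (e : Edge) → 0 < G e →
          Reachable G (proj₂ (ends e)) y → Reachable G (proj₁ (ends e)) y
  step₂ : ∀ {y} (e : Edge) → 0 < G e →
          Reachable G (proj₁ (ends e)) y → Reachable G (proj₂ (ends e)) y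

IsConnected : Multigraph → Set
IsConnected G = (x y : Vertex) → Reachable G x y

-- G is r-edge-connected: deleting any set F of fewer than r edges
-- (F e copies of the parallel class of e, F e ≤ G e) leaves G connected.
IsEdgeConnected : ℕ → Multigraph → Set
IsEdgeConnected r G =
  (F : Edge → ℕ) → ((e : Edge) → F e ≤ G e) → Σₑ F < r →
  IsConnected (λ e → G e ∸ F e)

module Submission where

-- For k = j + 1 the multigraph P_k is (P + M₀) + j (M₀ + M₁ + M₃ + M₄), once M₁, M₃ and M₄ are
-- identified among the six perfect matchings of P.  Both summands are 4-regular, and in both every
-- cut separating two nonempty vertex sets carries at least 4 edges; degrees and cut weights add
-- up, so P_k is 4k-regular with all cuts of weight at least 4k.  If deleting fewer than 4k edges
-- disconnected x from y, the vertices still reachable from y would span a cut all of whose at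
-- least 4k edges were deleted.  The finite facts about P are checked by exhaustive search.

open import Defs
open import Level using (Level)
open import Data.Nat using (ℕ; zero; suc; _+_; _*_; _∸_; _≤_; _<_; _≤?_; _<?_; z≤n)
  renaming (_≟_ to _≟ℕ_)
open import Data.Nat.Properties using (≤-trans; <⇒≱; ≮⇒≥; n≤0⇒n≡0; +-mono-≤; *-monoʳ-≤; *-zeroʳ; m∸n≡0⇒m≤n)
open import Data.Nat.Solver using (module +-*-Solver)
open import Data.Bool using (Bool; true; false; not; _∧_; _xor_; if_then_else_; T; T?)
  renaming (_≟_ to _≟ᵇ_)
open import Data.Bool.Properties using (T-∧; T-≡)
open import Data.Fin using (Fin; zero; suc; #_; toℕ) renaming (_≟_ to _≟ᶠ_)
open import Data.Fin.Properties using (all?; any?)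
open import Data.Fin.Subset
  using (Subset; inside; outside; _∈_; _∉_; _∩_; _∪_; ∁; ⁅_⁆; ⊥; _⊆_; _⊂_; _⊃_; Nonempty)
open import Data.Fin.Subset.Properties
  using (_∈?_; nonempty?; ⊆-antisym; x∈⁅x⁆; x∈⁅y⁆⇒x≡y; x∈p∩q⁺; x∈p∩q⁻; x∈p∪q⁺; x∈p∪q⁻; q⊆p∪q; x∉p⇒x∈∁p)
open import Data.Fin.Subset.Induction using (Acc; acc; ⊃-wellFounded)
open import Data.Product using (_×_; _,_; proj₁; proj₂; ∃-syntax)
open import Data.Sum using (inj₁; inj₂)
open import Data.List using (List; []; _∷_; map; allFin)
import Data.List as List
open import Data.List.Properties using (map-cong)
open import Data.List.Membership.Propositional using () renaming (_∈_ to _∈ˡ_)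
open import Data.List.Relation.Unary.All using (All) renaming (all? to allˡ?)
import Data.List.Relation.Unary.All as Allˡ
open import Data.List.Relation.Unary.Any using () renaming (any? to anyˡ?)
open import Data.Nat.ListAction using (sum)
open import Data.Vec using ([]; _∷_; lookup; tabulate)
open import Data.Vec.Properties using (≡-dec; lookup∘tabulate; []=⇒lookup; lookup⇒[]=)
open import Data.Unit using (tt)
open import Data.Empty using (⊥-elim)
open import Function using (_∘_; _⇔_; mk⇔; Equivalence)
open import Relation.Nullary using (Dec; does; yes; no; ¬_; ¬?; contradiction)
open import Relation.Nullary.Decidable using (_×-dec_; _⊎-dec_; _→-dec_; isYes; toWitness; fromWitness)
open import Relation.Unary using (Pred; Decidable)
open import Relation.Binary.PropositionalEquality
  using (_≡_; _≢_; _≗_; refl; sym; trans; cong; cong₂; subst; module ≡-Reasoning)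

open Equivalence using (to; from)

private
  variable
    n : ℕ
    ℓ : Level

allElements : (Fin n → Bool) → Bool
allElements {zero} p = true
allElements {suc n} p = p zero ∧ allElements (p ∘ suc)

allElements-complete : (p : Fin n → Bool) → (∀ i → T (p i)) → T (allElements p)
allElements-complete {zero} p h = tt
allElements-complete {suc n} p h = from T-∧ (h zero , allElements-complete (p ∘ suc) (h ∘ suc))

allSubsets : (Subset n → Bool) → Bool
allSubsets {zero} p = p []
allSubsets {suc n} p = allSubsets (p ∘ (inside ∷_)) ∧ allSubsets (p ∘ (outside ∷_))

allSubsets-sound : (p : Subset n → Bool) → T (allSubsets p) → ∀ S → T (p S)
allSubsets-sound {zero} p h [] = h
allSubsets-sound {suc n} p h (inside ∷ S) = allSubsets-sound (p ∘ (inside ∷_)) (proj₁ (to T-∧ h)) S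
allSubsets-sound {suc n} p h (outside ∷ S) = allSubsets-sound (p ∘ (outside ∷_)) (proj₂ (to T-∧ h)) S

∀-Subset-by-search : {P : Pred (Subset n) ℓ} (P? : Decidable P) →
  T (allSubsets (isYes ∘ P?)) → ∀ S → P S
∀-Subset-by-search P? h S = toWitness (allSubsets-sound (isYes ∘ P?) h S)

∈⇔T-lookup : ∀ {p : Subset n} {i} → i ∈ p ⇔ T (lookup p i)
∈⇔T-lookup {p = p} {i} = mk⇔ (from T-≡ ∘ []=⇒lookup) (lookup⇒[]= i p ∘ to T-≡)

∈-tabulate⇔ : ∀ {f : Fin n → Bool} {i} → i ∈ tabulate f ⇔ T (f i)
∈-tabulate⇔ {f = f} {i} = subst (λ b → i ∈ tabulate f ⇔ T b) (lookup∘tabulate f i) ∈⇔T-lookup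

lookup≡false⇒∉ : ∀ {p : Subset n} {i} → lookup p i ≡ false → i ∉ p
lookup≡false⇒∉ p[i]≡false i∈p = subst T p[i]≡false (to ∈⇔T-lookup i∈p)

tabulate≡⇒≗ : ∀ {f : Fin n → Bool} {v} → tabulate f ≡ v → f ≗ lookup v
tabulate≡⇒≗ {f = f} eq i = trans (sym (lookup∘tabulate f i)) (cong (λ v → lookup v i) eq)

isEmpty : Subset n → Bool
isEmpty [] = true
isEmpty (b ∷ p) = not b ∧ isEmpty p

isSingleton : Subset n → Bool
isSingleton [] = false
isSingleton (true ∷ p) = isEmpty p
isSingleton (false ∷ p) = isSingleton p

isEmpty-⊥ : T (isEmpty (⊥ {n}))
isEmpty-⊥ {zero} = tt
isEmpty-⊥ {suc n} = isEmpty-⊥ {n}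

isSingleton-⁅⁆ : (i : Fin n) → T (isSingleton ⁅ i ⁆)
isSingleton-⁅⁆ {suc n} zero = isEmpty-⊥ {n}
isSingleton-⁅⁆ (suc i) = isSingleton-⁅⁆ i

_incident?_ : (x : Vertex) (e : Edge) → Dec (x incident e)
x incident? e = (proj₁ (ends e) ≟ᶠ x) ⊎-dec (proj₂ (ends e) ≟ᶠ x)

-- Written out literally, so that the search in perfectMatchings-complete does not recompute incidences.
edgesAt : Vertex → Subset 15
edgesAt x = lookup
  ( (true ∷ false ∷ false ∷ false ∷ true ∷ false ∷ false ∷ false ∷ false ∷ false ∷ true ∷ false ∷ false ∷ false ∷ false ∷ [])
  ∷ (true ∷ true ∷ false ∷ false ∷ false ∷ false ∷ false ∷ false ∷ false ∷ false ∷ false ∷ true ∷ false ∷ false ∷ false ∷ [])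
  ∷ (false ∷ true ∷ true ∷ false ∷ false ∷ false ∷ false ∷ false ∷ false ∷ false ∷ false ∷ false ∷ true ∷ false ∷ false ∷ [])
  ∷ (false ∷ false ∷ true ∷ true ∷ false ∷ false ∷ false ∷ false ∷ false ∷ false ∷ false ∷ false ∷ false ∷ true ∷ false ∷ [])
  ∷ (false ∷ false ∷ false ∷ true ∷ true ∷ false ∷ false ∷ false ∷ false ∷ false ∷ false ∷ false ∷ false ∷ false ∷ true ∷ [])
  ∷ (false ∷ false ∷ false ∷ false ∷ false ∷ true ∷ false ∷ false ∷ false ∷ true ∷ true ∷ false ∷ false ∷ false ∷ false ∷ [])
  ∷ (false ∷ false ∷ false ∷ false ∷ false ∷ false ∷ false ∷ true ∷ true ∷ false ∷ false ∷ true ∷ false ∷ false ∷ false ∷ [])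
  ∷ (false ∷ false ∷ false ∷ false ∷ false ∷ true ∷ true ∷ false ∷ false ∷ false ∷ false ∷ false ∷ true ∷ false ∷ false ∷ [])
  ∷ (false ∷ false ∷ false ∷ false ∷ false ∷ false ∷ false ∷ false ∷ true ∷ true ∷ false ∷ false ∷ false ∷ true ∷ false ∷ [])
  ∷ (false ∷ false ∷ false ∷ false ∷ false ∷ false ∷ true ∷ true ∷ false ∷ false ∷ false ∷ false ∷ false ∷ false ∷ true ∷ [])
  ∷ []) x

edgesAt-incident : ∀ x e → lookup (edgesAt x) e ≡ isYes (x incident? e)
edgesAt-incident = toWitness {a? = all? λ x → all? λ e → lookup (edgesAt x) e ≟ᵇ isYes (x incident? e)} tt

∈-edgesAt⇔ : ∀ {x e} → e ∈ edgesAt x ⇔ x incident e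
∈-edgesAt⇔ {x} {e} = mk⇔
  (λ e∈ → toWitness (subst T (edgesAt-incident x e) (to ∈⇔T-lookup e∈)))
  (λ x~e → from ∈⇔T-lookup (subst T (sym (edgesAt-incident x e)) (fromWitness x~e)))

IsPerfectMatchingᵇ : Subset 15 → Set
IsPerfectMatchingᵇ S = T (allElements λ x → isSingleton (S ∩ edgesAt x))

perfectMatching⇒ᵇ : ∀ {N} → IsPerfectMatching N → IsPerfectMatchingᵇ (tabulate N)
perfectMatching⇒ᵇ {N} pm = allElements-complete _ singleton
  where
  singleton : ∀ x → T (isSingleton (tabulate N ∩ edgesAt x))
  singleton x with pm x
  ... | e , e∈N , x~e , unique = subst (T ∘ isSingleton) (⊆-antisym ⁅e⁆⊆ ⊆⁅e⁆) (isSingleton-⁅⁆ e)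
    where
    ⊆⁅e⁆ : tabulate N ∩ edgesAt x ⊆ ⁅ e ⁆
    ⊆⁅e⁆ {f} f∈ with x∈p∩q⁻ (tabulate N) (edgesAt x) f∈
    ... | f∈N , f∈x =
      subst (_∈ ⁅ e ⁆) (sym (unique f (to T-≡ (to (∈-tabulate⇔ {f = N}) f∈N)) (to ∈-edgesAt⇔ f∈x))) (x∈⁅x⁆ e)
    ⁅e⁆⊆ : ⁅ e ⁆ ⊆ tabulate N ∩ edgesAt x
    ⁅e⁆⊆ {f} f∈ with x∈⁅y⁆⇒x≡y e f∈
    ... | refl = x∈p∩q⁺ (from (∈-tabulate⇔ {f = N}) (from T-≡ e∈N) , from ∈-edgesAt⇔ x~e)

edgeSet : List ℕ → Subset 15
edgeSet es = tabulate λ e → isYes (anyˡ? (toℕ e ≟ℕ_) es)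

matchingThrough : Fin 5 → Subset 15
matchingThrough i = lookup
  ( edgeSet (1 ∷ 3 ∷ 6 ∷ 8 ∷ 10 ∷ [])
  ∷ edgeSet (2 ∷ 4 ∷ 6 ∷ 9 ∷ 11 ∷ [])
  ∷ edgeSet (0 ∷ 3 ∷ 7 ∷ 9 ∷ 12 ∷ [])
  ∷ edgeSet (1 ∷ 4 ∷ 5 ∷ 7 ∷ 13 ∷ [])
  ∷ edgeSet (0 ∷ 2 ∷ 5 ∷ 8 ∷ 14 ∷ [])
  ∷ []) i

-- M i is the paper's M_{i+1}, matching the indexing of spoke.
M : Fin 5 → EdgeSet
M i = lookup (matchingThrough i)

perfectMatchings : List (Subset 15)
perfectMatchings = tabulate M₀ ∷ List.tabulate matchingThrough

perfectMatchings-complete : ∀ S → IsPerfectMatchingᵇ S → S ∈ˡ perfectMatchings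
perfectMatchings-complete = ∀-Subset-by-search
  (λ S → T? _ →-dec anyˡ? (≡-dec _≟ᵇ_ S) perfectMatchings) tt

spoke-determines-matching : ∀ i →
  All (λ S → T (lookup S (spoke i)) → S ≢ tabulate M₀ → S ≡ matchingThrough i) perfectMatchings
spoke-determines-matching = toWitness {a? = all? λ i → allˡ? (λ S →
  T? _ →-dec ¬? (≡-dec _≟ᵇ_ S (tabulate M₀)) →-dec ≡-dec _≟ᵇ_ S (matchingThrough i)) perfectMatchings} tt

matchingAt-unique : ∀ {N} i → IsMatchingAt i N → N ≗ M i
matchingAt-unique {N} i (pm , (e , N≢M₀) , spoke∈N) = tabulate≡⇒≗ {f = N}
  (Allˡ.lookup (spoke-determines-matching i) (perfectMatchings-complete _ (perfectMatching⇒ᵇ pm))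
    (subst T (sym (lookup∘tabulate N (spoke i))) (from T-≡ spoke∈N))
    (λ N≡M₀ → N≢M₀ (trans (tabulate≡⇒≗ {f = N} N≡M₀ e) (lookup∘tabulate M₀ e))))

Σₑ-cong : ∀ {f g : Edge → ℕ} → f ≗ g → Σₑ f ≡ Σₑ g
Σₑ-cong f≗g = cong sum (map-cong f≗g (allFin 15))

Σₑ-mono-≤ : ∀ {f g : Edge → ℕ} → (∀ e → f e ≤ g e) → Σₑ f ≤ Σₑ g
Σₑ-mono-≤ {f} {g} f≤g = go (allFin 15)
  where
  go : ∀ es → sum (map f es) ≤ sum (map g es)
  go [] = z≤n
  go (e ∷ es) = +-mono-≤ (f≤g e) (go es)

sum-map-+* : ∀ {A : Set} (f g : A → ℕ) j xs →
  sum (map (λ x → f x + j * g x) xs) ≡ sum (map f xs) + j * sum (map g xs)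
sum-map-+* f g j [] = sym (*-zeroʳ j)
sum-map-+* f g j (x ∷ xs) = begin
  f x + j * g x + sum (map (λ x → f x + j * g x) xs)    ≡⟨ cong (f x + j * g x +_) (sum-map-+* f g j xs) ⟩
  f x + j * g x + (sum (map f xs) + j * sum (map g xs)) ≡⟨ regroup (f x) (g x) j (sum (map f xs)) (sum (map g xs)) ⟩
  f x + sum (map f xs) + j * (g x + sum (map g xs))     ∎
  where
  open ≡-Reasoning
  open +-*-Solver
  regroup : ∀ a b j c d → a + j * b + (c + j * d) ≡ a + c + j * (b + d)
  regroup = solve 5 (λ a b j c d → a :+ j :* b :+ (c :+ j :* d) := a :+ c :+ j :* (b :+ d)) refl

_⊕_·_ : Multigraph → ℕ → Multigraph → Multigraph
(G ⊕ j · H) e = G e + j * H e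

Σₑ-if-⊕· : ∀ (c : Edge → Bool) {K} G H j → K ≗ G ⊕ j · H →
  Σₑ (λ e → if c e then K e else 0) ≡
  Σₑ (λ e → if c e then G e else 0) + j * Σₑ (λ e → if c e then H e else 0)
Σₑ-if-⊕· c {K} G H j K≗ =
  trans (Σₑ-cong if-distrib) (sum-map-+* (λ e → if c e then G e else 0) (λ e → if c e then H e else 0) j (allFin 15))
  where
  if-distrib : ∀ e → (if c e then K e else 0) ≡ (if c e then G e else 0) + j * (if c e then H e else 0)
  if-distrib e with c e
  ... | true = K≗ e
  ... | false = sym (*-zeroʳ j)

⊕·-regular : ∀ {a b G H K} j → IsRegular a G → IsRegular b H → K ≗ G ⊕ j · H → IsRegular (a + j * b) K
⊕·-regular {G = G} {H} j G-regular H-regular K≗ x =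
  -- does (x incident? e) is definitionally the incidence test used in degree.
  trans (Σₑ-if-⊕· (λ e → does (x incident? e)) G H j K≗)
        (cong₂ (λ dG dH → dG + j * dH) (G-regular x) (H-regular x))

crosses : Subset 10 → Edge → Bool
crosses S e = lookup S (proj₁ (ends e)) xor lookup S (proj₂ (ends e))

cut : Multigraph → Subset 10 → ℕ
cut G S = Σₑ λ e → if crosses S e then G e else 0

CutBound : ℕ → Multigraph → Set
CutBound r G = ∀ S → Nonempty S → Nonempty (∁ S) → r ≤ cut G S

⊕·-cutBound : ∀ {a b G H K} j → CutBound a G → CutBound b H → K ≗ G ⊕ j · H → CutBound (a + j * b) K
⊕·-cutBound {a} {b} {G} {H} j G-cut H-cut K≗ S S≢∅ ∁S≢∅ =
  subst (a + j * b ≤_) (sym (Σₑ-if-⊕· (crosses S) G H j K≗))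
    (+-mono-≤ (G-cut S S≢∅ ∁S≢∅) (*-monoʳ-≤ j (H-cut S S≢∅ ∁S≢∅)))

Closed : Multigraph → Subset 10 → Set
Closed G S = ∀ e → 0 < G e → ¬ T (crosses S e)

closed⇒cut≤ : ∀ G F {S} → Closed (λ e → G e ∸ F e) S → cut G S ≤ Σₑ F
closed⇒cut≤ G F {S} closed = Σₑ-mono-≤ crossing≤F
  where
  crossing≤F : ∀ e → (if crosses S e then G e else 0) ≤ F e
  crossing≤F e with crosses S e in c
  ... | false = z≤n
  ... | true with 0 <? G e ∸ F e
  ...   | yes G-F>0 = contradiction (subst T (sym c) tt) (closed e G-F>0)
  ...   | no G-F≯0 = m∸n≡0⇒m≤n (n≤0⇒n≡0 (≮⇒≥ G-F≯0))

module _ (G : Multigraph) (y : Vertex) where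

  ReachesY : Subset 10 → Set
  ReachesY S = ∀ {w} → w ∈ S → Reachable G w y

  crossingEdge⇒escape : ∀ {S e} → 0 < G e → T (crosses S e) → ReachesY S →
    ∃[ w ] (w ∉ S × Reachable G w y)
  crossingEdge⇒escape {S} {e} e∈G c reach
    with lookup S (proj₁ (ends e)) in a∈S | lookup S (proj₂ (ends e)) in b∈S
  ... | true  | false = proj₂ (ends e) , lookup≡false⇒∉ b∈S , step₂ e e∈G (reach (lookup⇒[]= _ S a∈S))
  ... | false | true  = proj₁ (ends e) , lookup≡false⇒∉ a∈S , step₁ e e∈G (reach (lookup⇒[]= _ S b∈S))
  ... | true  | true  = ⊥-elim c
  ... | false | false = ⊥-elim c

  closure : ∀ S → Acc _⊃_ S → y ∈ S → ReachesY S → ∃[ S′ ] (y ∈ S′ × ReachesY S′ × Closed G S′)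
  closure S (acc rec) y∈S reach with any? (λ e → (0 <? G e) ×-dec T? (crosses S e))
  ... | no noCrossing = S , y∈S , reach , λ e e∈G c → noCrossing (e , e∈G , c)
  ... | yes (e , e∈G , c) with crossingEdge⇒escape e∈G c reach
  ...   | w , w∉S , w→y = closure (⁅ w ⁆ ∪ S) (rec S⊂S′) (q⊆p∪q ⁅ w ⁆ S y∈S) reach′
    where
    S⊂S′ : S ⊂ ⁅ w ⁆ ∪ S
    S⊂S′ = q⊆p∪q ⁅ w ⁆ S , w , x∈p∪q⁺ (inj₁ (x∈⁅x⁆ w)) , w∉S
    reach′ : ReachesY (⁅ w ⁆ ∪ S)
    reach′ v∈ with x∈p∪q⁻ ⁅ w ⁆ S v∈
    ... | inj₁ v∈⁅w⁆ rewrite x∈⁅y⁆⇒x≡y w v∈⁅w⁆ = w→y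
    ... | inj₂ v∈S = reach v∈S

  reachabilityClosure : ∃[ S ] (y ∈ S × ReachesY S × Closed G S)
  reachabilityClosure = closure ⁅ y ⁆ (⊃-wellFounded ⁅ y ⁆) (x∈⁅x⁆ y) reaches
    where
    reaches : ReachesY ⁅ y ⁆
    reaches v∈ rewrite x∈⁅y⁆⇒x≡y y v∈ = here

cutBound⇒edgeConnected : ∀ {r G} → CutBound r G → IsEdgeConnected r G
cutBound⇒edgeConnected {r} {G} cuts F _ ΣF<r x y with reachabilityClosure (λ e → G e ∸ F e) y
... | S , y∈S , reach , closed with x ∈? S
...   | yes x∈S = reach x∈S
...   | no x∉S =
  contradiction (≤-trans (cuts S (y , y∈S) (x , x∉p⇒x∈∁p x∉S)) (closed⇒cut≤ G F {S} closed)) (<⇒≱ ΣF<r)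

P+M₀ : Multigraph
P+M₀ e = 1 + [ M₀ e ]

M₀+M₁+M₃+M₄ : Multigraph
M₀+M₁+M₃+M₄ e = [ M₀ e ] + ([ M (# 0) e ] + [ M (# 2) e ] + [ M (# 3) e ])

Pk-suc : ∀ j {M₁ M₃ M₄} → M₁ ≗ M (# 0) → M₃ ≗ M (# 2) → M₄ ≗ M (# 3) →
  Pk (suc j) M₁ M₃ M₄ ≗ P+M₀ ⊕ j · M₀+M₁+M₃+M₄
Pk-suc j M₁≗ M₃≗ M₄≗ e rewrite M₁≗ e | M₃≗ e | M₄≗ e =
  solve 3 (λ j a s → con 1 :+ (a :+ j :* a) :+ j :* s := con 1 :+ a :+ j :* (a :+ s)) refl
    j [ M₀ e ] ([ M (# 0) e ] + [ M (# 2) e ] + [ M (# 3) e ])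
  where open +-*-Solver

P+M₀-regular : IsRegular 4 P+M₀
P+M₀-regular = toWitness {a? = all? λ x → degree P+M₀ x ≟ℕ 4} tt

M₀+M₁+M₃+M₄-regular : IsRegular 4 M₀+M₁+M₃+M₄
M₀+M₁+M₃+M₄-regular = toWitness {a? = all? λ x → degree M₀+M₁+M₃+M₄ x ≟ℕ 4} tt

P+M₀-cutBound : CutBound 4 P+M₀
P+M₀-cutBound = ∀-Subset-by-search (λ S → nonempty? S →-dec nonempty? (∁ S) →-dec 4 ≤? cut P+M₀ S) tt

M₀+M₁+M₃+M₄-cutBound : CutBound 4 M₀+M₁+M₃+M₄
M₀+M₁+M₃+M₄-cutBound =
  ∀-Subset-by-search (λ S → nonempty? S →-dec nonempty? (∁ S) →-dec 4 ≤? cut M₀+M₁+M₃+M₄ S) tt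

lemma2p4 : (M₁ M₃ M₄ : EdgeSet) →
    IsMatchingAt (# 0) M₁ → IsMatchingAt (# 2) M₃ → IsMatchingAt (# 3) M₄ →
    (k : ℕ) → 1 ≤ k →
    IsEdgeConnected (4 * k) (Pk k M₁ M₃ M₄) × IsRegular (4 * k) (Pk k M₁ M₃ M₄)
lemma2p4 M₁ M₃ M₄ M₁-at M₃-at M₄-at (suc j) _ =
  subst (λ r → IsEdgeConnected r Pₖ) 4+j*4≡4*k
    (cutBound⇒edgeConnected (⊕·-cutBound j P+M₀-cutBound M₀+M₁+M₃+M₄-cutBound Pₖ≗)) ,
  subst (λ r → IsRegular r Pₖ) 4+j*4≡4*k (⊕·-regular j P+M₀-regular M₀+M₁+M₃+M₄-regular Pₖ≗)
  where
  Pₖ : Multigraph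
  Pₖ = Pk (suc j) M₁ M₃ M₄
  Pₖ≗ : Pₖ ≗ P+M₀ ⊕ j · M₀+M₁+M₃+M₄
  Pₖ≗ = Pk-suc j (matchingAt-unique (# 0) M₁-at) (matchingAt-unique (# 2) M₃-at) (matchingAt-unique (# 3) M₄-at)
  4+j*4≡4*k : 4 + j * 4 ≡ 4 * suc j
  4+j*4≡4*k = solve 1 (λ j → con 4 :+ j :* con 4 := con 4 :* (con 1 :+ j)) refl j
    where open +-*-Solver
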